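{- Let $X$ be a Noetherian topological space, let $\Phi:X\longrightarrow X$ be a continuous map, let $x\in X$, let $Y$ be a closed subset of $X$, and let $S:=\{n\colon \Phi^n(x)\in Y\}$. If $S$ has positive Banach density, then $S$ contains an infinite arithmetic progression.
   Context: A topological space is Noetherian if it has no infinite strictly descending chain of closed subsets. $\Phi^n$ denotes the $n$-th iterate. For $S\subseteq\mathbb{N}$, the Banach density is $\delta(S):=\limsup_{|I|\to\infty}\frac{|S\cap I|}{|I|}$, the $\limsup$ taken over intervals $I$ of natural numbers. An infinite arithmetic progression is a set $\{an+b\colon n\ge 0\}$ with $a,b\in\mathbb{N}$, $a\ge 1$. -}

module Defs where

open import Level using (0ℓ)
open import Data.Nat using (ℕ; zero; suc; _+_; _*_; _≤_; _<_)
open import Data.Fin using (Fin)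
open import Data.Product using (Σ; _×_; ∃; ∃-syntax)
open import Data.Sum using (_⊎_)
open import Data.Empty using (⊥)
open import Relation.Nullary using (¬_)
open import Relation.Unary using (Pred; _⊆_; _⊂_; _≐_; _∪_; ∅; U)
open import Relation.Binary.PropositionalEquality using (_≡_)
open import Function.Definitions using (Injective)

record Topology (X : Set) : Set₁ where
  field
    IsClosed      : Pred X 0ℓ → Set
    closed-resp   : ∀ {A B : Pred X 0ℓ} → A ≐ B → IsClosed A → IsClosed B
    closed-∅      : IsClosed ∅
    closed-U      : IsClosed U
    closed-∪      : ∀ {A B : Pred X 0ℓ} → IsClosed A → IsClosed B → IsClosed (A ∪ B)
    closed-⋂      : (I : Set) (F : I → Pred X 0ℓ) → (∀ i → IsClosed (F i)) →
                    IsClosed (λ x → ∀ i → F i x)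

open Topology public

Noetherian : {X : Set} → Topology X → Set₁
Noetherian {X} τ =
  ¬ (Σ (ℕ → Pred X 0ℓ) λ C → (∀ n → IsClosed τ (C n)) × (∀ n → C (suc n) ⊂ C n))

Continuous : {X : Set} → Topology X → (X → X) → Set₁
Continuous {X} τ Φ = ∀ (A : Pred X 0ℓ) → IsClosed τ A → IsClosed τ (λ x → A (Φ x))

iter : {X : Set} → (X → X) → ℕ → X → X
iter Φ zero    x = x
iter Φ (suc n) x = Φ (iter Φ n x)

AtLeastInInterval : Pred ℕ 0ℓ → ℕ → ℕ → ℕ → Set
AtLeastInInterval S a ℓ k =
  Σ (Fin k → ℕ) λ f → Injective _≡_ _≡_ f × (∀ i → a ≤ f i × f i < a + ℓ × S (f i))

-- Positive Banach density: limsup_{|I|→∞} |S ∩ I|/|I| > 0, i.e. there is a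
-- rational ε = p/q > 0 such that for every L there is an interval I = [a, a+ℓ)
-- with ℓ ≥ L, ℓ > 0 and |S ∩ I| ≥ ε·|I|.
PositiveBanachDensity : Pred ℕ 0ℓ → Set
PositiveBanachDensity S =
  ∃[ p ] ∃[ q ] (0 < p × 0 < q ×
    (∀ L → ∃[ a ] ∃[ ℓ ] (L ≤ ℓ × 0 < ℓ ×
       ∃[ k ] (p * ℓ ≤ q * k × AtLeastInInterval S a ℓ k))))

ContainsInfiniteAP : Pred ℕ 0ℓ → Set
ContainsInfiniteAP S = ∃[ a ] ∃[ b ] (1 ≤ a × (∀ n → S (a * n + b)))

-- Write V(W) = {n : Φⁿ(x) ∈ W}. In a long interval where V(W) has density at least 1/c,
-- the elements of V(W) with no other element of V(W) among the next j = 4c + 1 integers are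
-- j-separated, hence rare; so most elements have such a partner, and pigeonholing the
-- distance (first over d ≤ j, then over the infinitely many intervals) gives a d ≥ 1 for
-- which V(W) ∩ (V(W) − d) = V(W ∩ Φ⁻ᵈ W) still has positive Banach density. If W ⊆ Φ⁻ᵈ W,
-- any n ∈ V(W) yields the progression n + dℕ ⊆ V(W); otherwise the closed set W ∩ Φ⁻ᵈ W is
-- strictly smaller than W. Starting from W = Y and assuming no progression, this produces an
-- infinite strictly descending chain of closed sets, impossible in a Noetherian space.

module Submission where

open import Defs
open import Level using (0ℓ)
open import Axiom.ExcludedMiddle using (ExcludedMiddle)
open import Relation.Unary using (Pred)

module Orbits {X : Set} where
  open import Data.Bool using (Bool; true; false)
  open import Data.Nat using (ℕ; zero; suc; _+_; _*_; z≤n; s≤s)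
  open import Data.Nat.Properties using (+-assoc; *-zeroʳ; *-suc)
  open import Data.Product using (Σ-syntax; _×_; _,_; proj₁; proj₂)
  open import Function using (_∘_)
  open import Relation.Nullary using (¬_)
  open import Relation.Unary using (_⊆_; _⊂_; _∩_)
  open import Relation.Binary.PropositionalEquality using (_≡_; refl; sym; trans; cong; subst)

  iter-+ : ∀ (Φ : X → X) m n x → iter Φ (m + n) x ≡ iter Φ m (iter Φ n x)
  iter-+ Φ zero    n x = refl
  iter-+ Φ (suc m) n x = cong Φ (iter-+ Φ m n x)

  continuous-iter : ∀ (τ : Topology X) {Φ} → Continuous τ Φ → ∀ n → Continuous τ (iter Φ n)
  continuous-iter τ     cont zero    A cA = cA
  continuous-iter τ {Φ} cont (suc n) A cA = continuous-iter τ cont n (λ y → A (Φ y)) (cont A cA)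

  closed-∩ : ∀ (τ : Topology X) {A B} → IsClosed τ A → IsClosed τ B → IsClosed τ (A ∩ B)
  closed-∩ τ {A} {B} cA cB =
    closed-resp τ ((λ h → h true , h false) , λ { (a , b) → λ { true → a ; false → b } })
      (closed-⋂ τ Bool F λ { true → cA ; false → cB })
    where
    F : Bool → Pred X 0ℓ
    F true  = A
    F false = B

  Shrinkable : Topology X → (Pred X 0ℓ → Set) → Set₁
  Shrinkable τ P = ∀ {A} → IsClosed τ A → P A → Σ[ B ∈ Pred X 0ℓ ] (IsClosed τ B × P B × B ⊂ A)

  noetherian-no-shrinking : ∀ {τ : Topology X} → Noetherian τ → ∀ {P} → Shrinkable τ P →
                            ∀ {A} → IsClosed τ A → ¬ P A
  noetherian-no-shrinking {τ} noeth {P} shrink {A} cA pA =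
    noeth (proj₁ ∘ chain , proj₁ ∘ proj₂ ∘ chain , λ n → proj₂ (proj₂ (proj₂ (step (chain n)))))
    where
    Good : Set₁
    Good = Σ[ B ∈ Pred X 0ℓ ] (IsClosed τ B × P B)

    step : (G : Good) → Σ[ B ∈ Pred X 0ℓ ] (IsClosed τ B × P B × B ⊂ proj₁ G)
    step (B , cB , pB) = shrink cB pB

    chain : ℕ → Good
    chain zero    = A , cA , pA
    chain (suc n) with step (chain n)
    ... | B , cB , pB , _ = B , cB , pB

  Visits : (X → X) → X → Pred X 0ℓ → Pred ℕ 0ℓ
  Visits Φ x W n = W (iter Φ n x)

  invariant⇒AP : ∀ {Φ x W} d → W ⊆ W ∘ iter Φ (suc d) → ∀ {b} → Visits Φ x W b →
                 ContainsInfiniteAP (Visits Φ x W)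
  invariant⇒AP {Φ = Φ} {x} {W} d inv {b} wb = suc d , b , s≤s z≤n , visits
    where
    visits : ∀ m → W (iter Φ (suc d * m + b) x)
    visits zero    = subst (λ k → W (iter Φ (k + b) x)) (sym (*-zeroʳ (suc d))) wb
    visits (suc m) = subst (λ k → W (iter Φ k x)) eq
                       (subst W (sym (iter-+ Φ (suc d) _ x)) (inv (visits m)))
      where
      eq : suc d + (suc d * m + b) ≡ suc d * suc m + b
      eq = trans (sym (+-assoc (suc d) _ b)) (cong (_+ b) (sym (*-suc (suc d) m)))

module Density (em : ExcludedMiddle 0ℓ) where
  open import Algebra.Properties.CommutativeSemigroup using (interchange)
  open import Axiom.DoubleNegationElimination using (em⇒dne)
  open import Data.Empty using (⊥-elim)
  open import Data.Fin using (Fin; zero; suc; toℕ; fromℕ<)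
  open import Data.Fin.Properties using (injective⇒≤; toℕ-fromℕ<)
  open import Data.List using (List; []; _∷_; length)
  open import Data.List.Membership.Propositional using (_∈_)
  open import Data.List.Relation.Unary.Any using (here; there; index)
  open import Data.Nat using (ℕ; zero; suc; _+_; _*_; _≤_; _<_; z≤n; s≤s; >-nonZero)
  open import Data.Nat.Properties
  open import Data.Product using (Σ; ∃; ∃-syntax; _×_; _,_)
  open import Data.Sum using (_⊎_; inj₁; inj₂; [_,_])
  open import Relation.Nullary using (¬_; Dec; yes; no)
  open import Relation.Unary using (_⊆_; _∪_; _∩_; ⋃)
  open import Function using (_∘_)
  open import Relation.Binary.PropositionalEquality
    using (_≡_; refl; sym; trans; cong; cong₂; subst; setoid)
  import Data.List.Membership.Setoid.Properties as SetoidMembership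

  indicator : {P : Set} → Dec P → ℕ
  indicator (yes _) = 1
  indicator (no _)  = 0

  indicator-mono : {P Q : Set} → (P → Q) → (p : Dec P) (q : Dec Q) → indicator p ≤ indicator q
  indicator-mono f (yes _) (yes _) = ≤-refl
  indicator-mono f (yes p) (no ¬q) = ⊥-elim (¬q (f p))
  indicator-mono f (no _)  _       = z≤n

  indicator-⊎ : {P Q R : Set} → (R → P ⊎ Q) → (r : Dec R) (p : Dec P) (q : Dec Q) →
                indicator r ≤ indicator p + indicator q
  indicator-⊎ f (no _)  _        _        = z≤n
  indicator-⊎ f (yes _) (yes _)  _        = s≤s z≤n
  indicator-⊎ f (yes _) (no _)   (yes _)  = ≤-refl
  indicator-⊎ f (yes r) (no ¬p)  (no ¬q)  = ⊥-elim ([ ¬p , ¬q ] (f r))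

  count : Pred ℕ 0ℓ → ℕ → ℕ → ℕ
  count S a zero    = 0
  count S a (suc ℓ) = indicator (em {S a}) + count S (suc a) ℓ

  count-mono : ∀ {S T} → S ⊆ T → ∀ a ℓ → count S a ℓ ≤ count T a ℓ
  count-mono S⊆T a zero    = z≤n
  count-mono S⊆T a (suc ℓ) = +-mono-≤ (indicator-mono S⊆T em em) (count-mono S⊆T (suc a) ℓ)

  count-⊆∪ : ∀ {R S T} → R ⊆ S ∪ T → ∀ a ℓ → count R a ℓ ≤ count S a ℓ + count T a ℓ
  count-⊆∪ R⊆S∪T a zero    = z≤n
  count-⊆∪ {R} {S} {T} R⊆S∪T a (suc ℓ) = begin
    indicator (em {R a}) + count R (suc a) ℓ
      ≤⟨ +-mono-≤ (indicator-⊎ R⊆S∪T em em em) (count-⊆∪ R⊆S∪T (suc a) ℓ) ⟩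
    (iS + iT) + (cS + cT)  ≡⟨ interchange +-commutativeSemigroup iS iT cS cT ⟩
    (iS + cS) + (iT + cT)  ∎
    where
    open ≤-Reasoning
    iS = indicator (em {S a})
    iT = indicator (em {T a})
    cS = count S (suc a) ℓ
    cT = count T (suc a) ℓ

  count>0⇒∃ : ∀ {S} a ℓ → 0 < count S a ℓ → ∃ S
  count>0⇒∃ {S} a (suc ℓ) pos with em {S a}
  ... | yes s = a , s
  ... | no _  = count>0⇒∃ (suc a) ℓ pos

  elements : Pred ℕ 0ℓ → ℕ → ℕ → List ℕ
  elements S a zero = []
  elements S a (suc ℓ) with em {S a}
  ... | yes _ = a ∷ elements S (suc a) ℓ
  ... | no _  = elements S (suc a) ℓ

  length-elements : ∀ S a ℓ → length (elements S a ℓ) ≡ count S a ℓ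
  length-elements S a zero = refl
  length-elements S a (suc ℓ) with em {S a}
  ... | yes _ = cong suc (length-elements S (suc a) ℓ)
  ... | no _  = length-elements S (suc a) ℓ

  ∈-elements : ∀ {S a ℓ n} → a ≤ n → n < a + ℓ → S n → n ∈ elements S a ℓ
  ∈-elements {a = a} {zero} {n} a≤n n<a+0 s = ⊥-elim (≤⇒≯ a≤n (subst (n <_) (+-identityʳ a) n<a+0))
  ∈-elements {S} {a} {suc ℓ} {n} a≤n n<a+ℓ s with em {S a} | m≤n⇒m<n∨m≡n a≤n
  ... | yes _  | inj₂ refl = here refl
  ... | no ¬sa | inj₂ refl = ⊥-elim (¬sa s)
  ... | yes _  | inj₁ a<n  = there (∈-elements a<n (subst (n <_) (+-suc a ℓ) n<a+ℓ) s)
  ... | no _   | inj₁ a<n  = ∈-elements a<n (subst (n <_) (+-suc a ℓ) n<a+ℓ) s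

  AtLeastInInterval⇒≤count : ∀ {S a ℓ k} → AtLeastInInterval S a ℓ k → k ≤ count S a ℓ
  AtLeastInInterval⇒≤count {S} {a} {ℓ} (f , f-inj , f∈) =
    subst (_ ≤_) (length-elements S a ℓ) (injective⇒≤ {f = position} position-injective)
    where
    f∈elements : ∀ i → f i ∈ elements S a ℓ
    f∈elements i with f∈ i
    ... | a≤fi , fi<a+ℓ , s = ∈-elements a≤fi fi<a+ℓ s

    position = λ i → index (f∈elements i)

    position-injective : ∀ {i j} → position i ≡ position j → i ≡ j
    position-injective eq =
      f-inj (SetoidMembership.index-injective (setoid ℕ) (f∈elements _) (f∈elements _) eq)

  Sparse : ℕ → Pred ℕ 0ℓ → Set
  Sparse j P = ∀ {n} → P n → ∀ i → i < j → ¬ P (suc i + n)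

  -- g is the length of an initial stretch known to be free of P; each element of P
  -- then uses up j + 1 positions, only the last of which may stick out of the interval.
  sparse-count-after-gap : ∀ {j P} → Sparse j P → ∀ a ℓ g → g ≤ suc j →
                           (∀ i → i < g → ¬ P (i + a)) → g + suc j * count P a ℓ ≤ ℓ + suc j
  sparse-count-after-gap {j} sparse a zero g g≤K gap
    rewrite *-zeroʳ (suc j) | +-identityʳ g = g≤K
  sparse-count-after-gap {j} {P} sparse a (suc ℓ) zero g≤K gap with em {P a}
  ... | yes pa = subst (_≤ suc ℓ + suc j) (sym (*-suc (suc j) (count P (suc a) ℓ)))
                   (s≤s (sparse-count-after-gap sparse (suc a) ℓ j (n≤1+n j) shift))
    where
    shift : ∀ i → i < j → ¬ P (i + suc a)
    shift i i<j p = sparse pa i i<j (subst P (+-suc i a) p)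
  ... | no _   = m≤n⇒m≤1+n (sparse-count-after-gap sparse (suc a) ℓ 0 z≤n λ _ ())
  sparse-count-after-gap {j} {P} sparse a (suc ℓ) (suc g) g<K gap with em {P a}
  ... | yes pa = ⊥-elim (gap 0 (s≤s z≤n) pa)
  ... | no _   = s≤s (sparse-count-after-gap sparse (suc a) ℓ g (<⇒≤ g<K) shift)
    where
    shift : ∀ i → i < g → ¬ P (i + suc a)
    shift i i<g p = gap (suc i) (s≤s i<g) (subst P (+-suc i a) p)

  sparse-count : ∀ {j P} → Sparse j P → ∀ a ℓ → suc j * count P a ℓ ≤ ℓ + suc j
  sparse-count sparse a ℓ = sparse-count-after-gap sparse a ℓ 0 z≤n λ _ ()

  Returns : ℕ → Pred ℕ 0ℓ → Pred ℕ 0ℓ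
  Returns d S = S ∩ (S ∘ (d +_))

  Partnered : ℕ → Pred ℕ 0ℓ → Pred ℕ 0ℓ
  Partnered j S = ⋃ (Fin j) λ i → Returns (suc (toℕ i)) S

  Lonely : ℕ → Pred ℕ 0ℓ → Pred ℕ 0ℓ
  Lonely j S n = S n × (∀ i → i < j → ¬ S (suc i + n))

  Lonely-sparse : ∀ j S → Sparse j (Lonely j S)
  Lonely-sparse j S (_ , alone) i i<j (s , _) = alone i i<j s

  partnered-or-lonely : ∀ j S → S ⊆ Partnered j S ∪ Lonely j S
  partnered-or-lonely j S {n} s with em {Σ (Fin j) λ i → S (suc (toℕ i) + n)}
  ... | yes (i , s′) = inj₁ (i , s , s′)
  ... | no none      = inj₂ (s , λ i i<j s′ →
                         none (fromℕ< i<j , subst (λ k → S (suc k + n)) (sym (toℕ-fromℕ< i<j)) s′))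

  count-⋃-pigeonhole : ∀ m (F : Fin (suc m) → Pred ℕ 0ℓ) a ℓ →
                       ∃[ i ] (count (⋃ (Fin (suc m)) F) a ℓ ≤ suc m * count (F i) a ℓ)
  count-⋃-pigeonhole zero F a ℓ =
    zero , ≤-trans (count-mono (λ { (zero , p) → p }) a ℓ) (≤-reflexive (sym (*-identityˡ _)))
  count-⋃-pigeonhole (suc m) F a ℓ = choose (count-⋃-pigeonhole m (F ∘ suc) a ℓ)
    where
    split : count (⋃ _ F) a ℓ ≤ count (F zero) a ℓ + count (⋃ _ (F ∘ suc)) a ℓ
    split = count-⊆∪ (λ { (zero , p) → inj₁ p ; (suc i , p) → inj₂ (i , p) }) a ℓ

    choose : ∃[ i ] (count (⋃ _ (F ∘ suc)) a ℓ ≤ suc m * count (F (suc i)) a ℓ) →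
             ∃[ i ] (count (⋃ _ F) a ℓ ≤ suc (suc m) * count (F i) a ℓ)
    choose (i , bound) with ≤-total (count (F zero) a ℓ) (count (F (suc i)) a ℓ)
    ... | inj₁ first≤ = suc i , ≤-trans split (+-mono-≤ first≤ bound)
    ... | inj₂ ≤first = zero  , ≤-trans split (+-monoʳ-≤ _ (≤-trans bound (*-monoʳ-≤ (suc m) ≤first)))

  ¬∀⇒∃¬ : {A : Set} {P : A → Set} → ¬ (∀ x → P x) → ∃ λ x → ¬ P x
  ¬∀⇒∃¬ ¬all = em⇒dne em λ ¬∃ → ¬all λ x → em⇒dne em λ ¬p → ¬∃ (x , ¬p)

  infinite-pigeonhole : ∀ {m} (P : Fin m → ℕ → Set) → (∀ {i L L′} → L ≤ L′ → P i L′ → P i L) →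
                        (∀ L → ∃[ i ] P i L) → ∃[ i ] (∀ L → P i L)
  infinite-pigeonhole {zero} P anti some with some 0
  ... | () , _
  infinite-pigeonhole {suc m} P anti some with em {∀ L → P zero L}
  ... | yes always = zero , always
  ... | no ¬always =
    let (i , always) = infinite-pigeonhole (P ∘ suc) anti (avoid (¬∀⇒∃¬ ¬always)) in suc i , always
    where
    avoid : (∃ λ L₀ → ¬ P zero L₀) → ∀ L → ∃[ i ] P (suc i) L
    avoid (L₀ , ¬p) L with some (L + L₀)
    ... | zero  , p = ⊥-elim (¬p (anti (m≤n+m L₀ L) p))
    ... | suc i , p = i , anti (m≤m+n L L₀) p

  DenseWindow : ℕ → Pred ℕ 0ℓ → ℕ → Set
  DenseWindow c S L = ∃[ a ] ∃[ ℓ ] (L ≤ ℓ × ℓ ≤ c * count S a ℓ)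

  Dense : Pred ℕ 0ℓ → Set
  Dense S = ∃[ c ] (∀ L → DenseWindow c S L)

  DenseWindow-antitone : ∀ {c S L L′} → L ≤ L′ → DenseWindow c S L′ → DenseWindow c S L
  DenseWindow-antitone L≤L′ (a , ℓ , L′≤ℓ , dense) = a , ℓ , ≤-trans L≤L′ L′≤ℓ , dense

  Dense-mono : ∀ {S T} → S ⊆ T → Dense S → Dense T
  Dense-mono S⊆T (c , windows) = c , λ L →
    let (a , ℓ , L≤ℓ , dense) = windows L
    in  a , ℓ , L≤ℓ , ≤-trans dense (*-monoʳ-≤ c (count-mono S⊆T a ℓ))

  Dense⇒∃ : ∀ {S} → Dense S → ∃ S
  Dense⇒∃ {S} (c , windows) = let (a , ℓ , 1≤ℓ , dense) = windows 1 in count>0⇒∃ a ℓ (positive 1≤ℓ dense)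
    where
    positive : ∀ {a ℓ} → 1 ≤ ℓ → ℓ ≤ c * count S a ℓ → 0 < count S a ℓ
    positive {ℓ = ℓ} 1≤ℓ dense = n≢0⇒n>0 λ empty →
      n≮0 (≤-trans 1≤ℓ (subst (ℓ ≤_) (trans (cong (c *_) empty) (*-zeroʳ c)) dense))

  PositiveBanachDensity⇒Dense : ∀ {S} → PositiveBanachDensity S → Dense S
  PositiveBanachDensity⇒Dense {S} (p , q , 0<p , _ , windows) = q , λ L →
    let (a , ℓ , L≤ℓ , _ , k , pℓ≤qk , atLeast) = windows L
    in  a , ℓ , L≤ℓ , (begin
          ℓ                ≤⟨ m≤n*m ℓ p {{>-nonZero 0<p}} ⟩
          p * ℓ            ≤⟨ pℓ≤qk ⟩
          q * k            ≤⟨ *-monoʳ-≤ q (AtLeastInInterval⇒≤count atLeast) ⟩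
          q * count S a ℓ  ∎)
    where open ≤-Reasoning

  -- s, r, l are the numbers of all, partnered and lonely elements in an interval of length ℓ.
  partnered-count-bound : ∀ {c K ℓ s r l} → 4 * c ≤ K → K ≤ ℓ → ℓ ≤ c * s → s ≤ r + l →
                          K * l ≤ ℓ + K → ℓ ≤ K * r
  partnered-count-bound {c} {K} {ℓ} {s} {r} {l} 4c≤K K≤ℓ ℓ≤cs s≤r+l Kl≤ℓ+K =
    ≤-trans (m≤m+n ℓ ℓ) (+-cancelʳ-≤ (ℓ + ℓ) (ℓ + ℓ) (K * r) (begin
      (ℓ + ℓ) + (ℓ + ℓ)  ≡⟨ four-times ⟩
      4 * ℓ              ≤⟨ *-monoʳ-≤ 4 ℓ≤cs ⟩
      4 * (c * s)        ≡⟨ *-assoc 4 c s ⟨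
      4 * c * s          ≤⟨ *-monoˡ-≤ s 4c≤K ⟩
      K * s              ≤⟨ *-monoʳ-≤ K s≤r+l ⟩
      K * (r + l)        ≡⟨ *-distribˡ-+ K r l ⟩
      K * r + K * l      ≤⟨ +-monoʳ-≤ (K * r) (≤-trans Kl≤ℓ+K (+-monoʳ-≤ ℓ K≤ℓ)) ⟩
      K * r + (ℓ + ℓ)    ∎))
    where
    open ≤-Reasoning
    twice : 2 * ℓ ≡ ℓ + ℓ
    twice = cong (ℓ +_) (+-identityʳ ℓ)
    four-times : (ℓ + ℓ) + (ℓ + ℓ) ≡ 4 * ℓ
    four-times = sym (trans (*-distribʳ-+ ℓ 2 2) (cong₂ _+_ twice twice))

  returns-window : ∀ {S} c {a ℓ} → let j = suc (4 * c) ; K = suc j in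
                   K ≤ ℓ → ℓ ≤ c * count S a ℓ →
                   ∃[ i ] (ℓ ≤ (K * j) * count (Returns (suc (toℕ {j} i)) S) a ℓ)
  returns-window {S} c {a} {ℓ} K≤ℓ dense =
    let (i , pigeon) = count-⋃-pigeonhole (4 * c) (λ i → Returns (suc (toℕ i)) S) a ℓ
    in  i , (begin
          ℓ                                    ≤⟨ partnered-count-bound {c} {r = count (Partnered j S) a ℓ}
                                                    4c≤K K≤ℓ dense
                                                    (count-⊆∪ (partnered-or-lonely j S) a ℓ)
                                                    (sparse-count (Lonely-sparse j S) a ℓ) ⟩
          K * count (Partnered j S) a ℓ        ≤⟨ *-monoʳ-≤ K pigeon ⟩
          K * (j * count (Returns _ S) a ℓ)    ≡⟨ *-assoc K j _ ⟨
          (K * j) * count (Returns _ S) a ℓ    ∎)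
    where
    open ≤-Reasoning
    j = suc (4 * c)
    K = suc j
    4c≤K : 4 * c ≤ K
    4c≤K = ≤-trans (n≤1+n _) (n≤1+n _)

  Dense⇒Returns : ∀ {S} → Dense S → ∃[ d ] Dense (Returns (suc d) S)
  Dense⇒Returns {S} (c , windows) =
    let (i , always) = infinite-pigeonhole _ (λ {_} → DenseWindow-antitone {K * j}) long
    in  toℕ i , K * j , always
    where
    j = suc (4 * c)
    K = suc j
    long : ∀ L → ∃[ i ] DenseWindow (K * j) (Returns (suc (toℕ {j} i)) S) L
    long L =
      let (a , ℓ , L+K≤ℓ , dense) = windows (L + K)
          (i , returns)            = returns-window c (≤-trans (m≤n+m K L) L+K≤ℓ) dense
      in  i , a , ℓ , ≤-trans (m≤m+n L K) L+K≤ℓ , returns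

module Recurrence (em : ExcludedMiddle 0ℓ) {X : Set} (τ : Topology X) where
  open import Data.Nat using (suc)
  open import Data.Product using (_×_; _,_; proj₁; proj₂)
  open import Function using (_∘_)
  open import Relation.Nullary using (¬_)
  open import Relation.Unary using (_⊆_; _∩_)
  open import Relation.Binary.PropositionalEquality using (subst)
  open Orbits
  open Density em

  visits-shrinkable : ∀ {Φ} → Continuous τ Φ → ∀ {x Y} → ¬ ContainsInfiniteAP (Visits Φ x Y) →
                      Shrinkable τ (λ W → W ⊆ Y × Dense (Visits Φ x W))
  visits-shrinkable {Φ} cont {x} ¬ap {W} cW (W⊆Y , dense) =
    let (d , dense′) = Dense⇒Returns dense
        W′ = W ∩ (W ∘ iter Φ (suc d))

        returns⊆visits : Returns (suc d) (Visits Φ x W) ⊆ Visits Φ x W′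
        returns⊆visits {n} (w , w′) = w , subst W (iter-+ Φ (suc d) n x) w′

        not-invariant : ¬ (W ⊆ W′)
        not-invariant W⊆W′ =
          let (b , wb)          = Dense⇒∃ dense
              (a , c , 1≤a , ap) = invariant⇒AP {Φ = Φ} {x} {W} d (λ w → proj₂ (W⊆W′ w)) {b} wb
          in  ¬ap (a , c , 1≤a , W⊆Y ∘ ap)
    in  W′ , closed-∩ τ cW (continuous-iter τ cont (suc d) W cW) ,
        (W⊆Y ∘ proj₁ , Dense-mono returns⊆visits dense′) , proj₁ , not-invariant

open import Level using (suc)
open import Data.Empty using (⊥-elim)
open import Data.Product using (_,_)
open import Function using (id)
open import Relation.Nullary using (yes; no)
open Orbits
open Density using (PositiveBanachDensity⇒Dense)
open Recurrence using (visits-shrinkable)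

proposition3p1 : ExcludedMiddle 0ℓ → ExcludedMiddle (suc 0ℓ) →
    (X : Set) (τ : Topology X) → Noetherian τ →
    (Φ : X → X) → Continuous τ Φ → (x : X) →
    (Y : Pred X 0ℓ) → IsClosed τ Y →
    PositiveBanachDensity (λ n → Y (iter Φ n x)) →
    ContainsInfiniteAP (λ n → Y (iter Φ n x))
proposition3p1 em _ X τ noeth Φ cont x Y cY pbd with em {ContainsInfiniteAP (Visits Φ x Y)}
... | yes ap = ap
... | no ¬ap = ⊥-elim (noetherian-no-shrinking {τ = τ} noeth (visits-shrinkable em τ cont ¬ap) cY
                         (id , PositiveBanachDensity⇒Dense em {Visits Φ x Y} pbd))
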